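{- For any positive integer $n$, \[\lceil\sqrt n\rceil-1+\left\lceil\frac{n}{\lceil\sqrt n\rceil}\right\rceil=\lfloor\sqrt n\rfloor-1+\left\lceil\frac{n}{\lfloor\sqrt n\rfloor}\right\rceil.\] -}

module Defs where

open import Data.Nat using (ℕ; zero; suc; _+_; _*_; _∸_; _≤?_; _≟_)
open import Data.Nat.DivMod using (_/_)
open import Relation.Nullary using (yes; no)

-- Ceiling division ⌈ m / k ⌉ (k > 0); the value for k = 0 is a junk 0
-- and never used in the statement (both denominators are ≥ 1 for n ≥ 1).
⌈_/_⌉ : ℕ → ℕ → ℕ
⌈ m / zero ⌉ = 0
⌈ m / suc k ⌉ = (m + k) / suc k

sqrtBelow : ℕ → ℕ → ℕ
sqrtBelow n zero = zero
sqrtBelow n (suc k) with suc k * suc k ≤? n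
... | yes _ = suc k
... | no _ = sqrtBelow n k

⌊√_⌋ : ℕ → ℕ
⌊√ n ⌋ = sqrtBelow n n

⌈√_⌉ : ℕ → ℕ
⌈√ n ⌉ with ⌊√ n ⌋ * ⌊√ n ⌋ ≟ n
... | yes _ = ⌊√ n ⌋
... | no _ = suc ⌊√ n ⌋

-- Let a = ⌊√n⌋. For a perfect square both sides coincide. Otherwise ⌈√n⌉ = a + 1 and
-- n = a² + r with 0 < r ≤ 2a, so the identity amounts to ⌈n/a⌉ = ⌈n/(a+1)⌉ + 1: writing n
-- as (quotient)·(divisor) plus a remainder in (0, divisor], the two ceilings are a + 1 and a
-- when r ≤ a, and a + 2 and a + 1 when r > a.
module Submission where

open import Defs
open import Data.Nat using (ℕ; zero; suc; _+_; _*_; _∸_; _≤_; _<_; _≟_; _<?_; _≤?_; z≤n; s≤s)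
open import Data.Nat.Properties
open import Data.Nat.DivMod using (_/_; m<n⇒m/n≡0; m*n/n≡m; +-distrib-/-∣ʳ)
open import Data.Nat.Divisibility using (divides-refl)
open import Data.Nat.Tactic.RingSolver using (solve-∀)
open import Data.Product using (_,_)
open import Relation.Nullary using (yes; no; contradiction)
open import Relation.Binary.PropositionalEquality
open ≡-Reasoning

[m+kn]/n≡k : ∀ m k d → m < suc d → (m + k * suc d) / suc d ≡ k
[m+kn]/n≡k m k d m<n = begin
  (m + k * suc d) / suc d          ≡⟨ +-distrib-/-∣ʳ m (divides-refl k) ⟩
  m / suc d + k * suc d / suc d    ≡⟨ cong₂ _+_ (m<n⇒m/n≡0 m<n) (m*n/n≡m k (suc d)) ⟩
  k                                ∎

⌈[1+m+kn]/n⌉≡1+k : ∀ m k d → m ≤ d → ⌈ suc m + k * suc d / suc d ⌉ ≡ suc k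
⌈[1+m+kn]/n⌉≡1+k m k d m≤d = begin
  (suc m + k * suc d + d) / suc d  ≡⟨ cong (_/ suc d) (regroup m k d) ⟩
  (m + suc k * suc d) / suc d      ≡⟨ [m+kn]/n≡k m (suc k) d (s≤s m≤d) ⟩
  suc k                            ∎
  where
  regroup : ∀ m k d → suc m + k * suc d + d ≡ m + suc k * suc d
  regroup = solve-∀

⌈n/a⌉≡1+⌈n/[1+a]⌉ : ∀ a n → a * a < n → n < suc a * suc a → ⌈ n / a ⌉ ≡ suc ⌈ n / suc a ⌉
⌈n/a⌉≡1+⌈n/[1+a]⌉ zero n a²<n n<[1+a]² = contradiction a²<n (<⇒≱ n<[1+a]²)
⌈n/a⌉≡1+⌈n/[1+a]⌉ a@(suc b) n a²<n n<[1+a]² with m≤n⇒∃[o]m+o≡n a²<n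
... | o , refl with o <? a
...   | yes (s≤s o≤b) = begin
  ⌈ suc (a * a) + o / a ⌉                 ≡⟨ cong ⌈_/ a ⌉ (low₁ o b) ⟩
  ⌈ suc o + a * a / a ⌉                   ≡⟨ ⌈[1+m+kn]/n⌉≡1+k o a b o≤b ⟩
  suc a                                   ≡⟨ cong suc (⌈[1+m+kn]/n⌉≡1+k (suc o) b a (s≤s o≤b)) ⟨
  suc ⌈ suc (suc o) + b * suc a / suc a ⌉ ≡⟨ cong (λ m → suc ⌈ m / suc a ⌉) (low₂ o b) ⟨
  suc ⌈ suc (a * a) + o / suc a ⌉         ∎
  where
  low₁ : ∀ o b → suc (suc b * suc b) + o ≡ suc o + suc b * suc b
  low₁ = solve-∀
  low₂ : ∀ o b → suc (suc b * suc b) + o ≡ suc (suc o) + b * suc (suc b)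
  low₂ = solve-∀
...   | no o≮a with m≤n⇒∃[o]m+o≡n (≮⇒≥ o≮a)
...     | s , refl = begin
  ⌈ suc (a * a) + (a + s) / a ⌉           ≡⟨ cong ⌈_/ a ⌉ (high₁ s b) ⟩
  ⌈ suc s + suc a * a / a ⌉               ≡⟨ ⌈[1+m+kn]/n⌉≡1+k s (suc a) b s≤b ⟩
  suc (suc a)                             ≡⟨ cong suc (⌈[1+m+kn]/n⌉≡1+k s a a (m≤n⇒m≤1+n s≤b)) ⟨
  suc ⌈ suc s + a * suc a / suc a ⌉       ≡⟨ cong (λ m → suc ⌈ m / suc a ⌉) (high₂ s b) ⟨
  suc ⌈ suc (a * a) + (a + s) / suc a ⌉   ∎
  where
  high₁ : ∀ s b → suc (suc b * suc b) + (suc b + s) ≡ suc s + suc (suc b) * suc b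
  high₁ = solve-∀
  high₂ : ∀ s b → suc (suc b * suc b) + (suc b + s) ≡ suc s + suc b * suc (suc b)
  high₂ = solve-∀
  [1+a]² : ∀ b → suc (suc b) * suc (suc b) ≡ suc (suc b * suc b) + (suc b + suc b)
  [1+a]² = solve-∀
  s≤b : s ≤ b
  s≤b = ≤-pred (+-cancelˡ-< a s a (+-cancelˡ-< (suc (a * a)) (a + s) (a + a)
          (subst (suc (a * a) + (a + s) <_) ([1+a]² b) n<[1+a]²)))

nonsquare-identity : ∀ a n → a * a < n → n < suc a * suc a →
                     a + ⌈ n / suc a ⌉ ≡ a ∸ 1 + ⌈ n / a ⌉
nonsquare-identity zero n a²<n n<[1+a]² = contradiction a²<n (<⇒≱ n<[1+a]²)
nonsquare-identity a@(suc b) n a²<n n<[1+a]² = begin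
  a + ⌈ n / suc a ⌉        ≡⟨ +-suc b ⌈ n / suc a ⌉ ⟨
  b + suc ⌈ n / suc a ⌉    ≡⟨ cong (b +_) (⌈n/a⌉≡1+⌈n/[1+a]⌉ a n a²<n n<[1+a]²) ⟨
  b + ⌈ n / a ⌉            ∎

sqrtBelow-sq≤ : ∀ n k → sqrtBelow n k * sqrtBelow n k ≤ n
sqrtBelow-sq≤ n zero = z≤n
sqrtBelow-sq≤ n (suc k) with suc k * suc k ≤? n
... | yes k²≤n = k²≤n
... | no _ = sqrtBelow-sq≤ n k

sqrtBelow-<[1+]² : ∀ n k → n < suc k * suc k → n < suc (sqrtBelow n k) * suc (sqrtBelow n k)
sqrtBelow-<[1+]² n zero n<1 = n<1
sqrtBelow-<[1+]² n (suc k) n<[1+k]² with suc k * suc k ≤? n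
... | yes _ = n<[1+k]²
... | no k²≰n = sqrtBelow-<[1+]² n k (≰⇒> k²≰n)

n<[1+⌊√n⌋]² : ∀ n → n < suc ⌊√ n ⌋ * suc ⌊√ n ⌋
n<[1+⌊√n⌋]² n = sqrtBelow-<[1+]² n n (m≤m*n (suc n) (suc n))

propositionA1 : (n : ℕ) → 1 ≤ n → ⌈√ n ⌉ ∸ 1 + ⌈ n / ⌈√ n ⌉ ⌉ ≡ ⌊√ n ⌋ ∸ 1 + ⌈ n / ⌊√ n ⌋ ⌉
propositionA1 n _ with ⌊√ n ⌋ * ⌊√ n ⌋ ≟ n
... | yes _ = refl
... | no a²≢n = nonsquare-identity ⌊√ n ⌋ n (≤∧≢⇒< (sqrtBelow-sq≤ n n) a²≢n) (n<[1+⌊√n⌋]² n)
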